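{- Let $d\ge1$, $k_1,k_2\ge2^d$, and $n_1,n_2\ge d$ be integers. Then \[(n_1n_2)^d-d!\,f(n_1n_2,k_1+k_2,d)\le\big(n_1^d-d!\,f(n_1,k_1,d)\big)\big(n_2^d-d!\,f(n_2,k_2,d)\big).\]
   Context: A family $\mathcal{F}$ of subsets of $[n]$ shatters $A\subseteq[n]$ if for every $A'\subseteq A$ there is $F\in\mathcal{F}$ with $F\cap A=A'$; $f(n,k,d)$ is the maximum number of $d$-subsets of $[n]$ shattered by some $\mathcal{F}\subseteq 2^{[n]}$ with $|\mathcal{F}|\le k$. -}

module Defs where

open import Data.Nat using (ℕ; zero; suc; _⊔_)
open import Data.Bool using (Bool; true; false)
open import Data.Vec as Vec using (Vec)
open import Data.List using (List; []; _∷_; [_]; _++_; map; concatMap; length; filter; foldr)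
open import Data.List.Relation.Unary.Any using (Any; any?)
open import Data.Product using (∃; _×_; _,_)
open import Data.Fin.Subset using (Subset; _⊆_; _∩_; ∣_∣)
open import Data.Fin.Subset.Properties using (_⊆?_; anySubset?)
open import Data.Vec.Properties using (≡-dec)
open import Data.Bool.Properties using () renaming (_≟_ to _≟B_)
open import Data.Nat.Properties using () renaming (_≟_ to _≟ℕ_)
open import Relation.Nullary using (Dec; yes; no; ¬_)
open import Relation.Nullary.Decidable using (_×-dec_; ¬?)
open import Relation.Binary.PropositionalEquality using (_≡_)

-- A family of subsets of [n], given as a list of its members
-- (repetitions are harmless: only the set of members matters).
Family : ℕ → Set
Family n = List (Subset n)

Shatters : ∀ {n} → Family n → Subset n → Set
Shatters 𝓕 A = ∀ A' → A' ⊆ A → Any (λ F → F ∩ A ≡ A') 𝓕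

_≟S_ : ∀ {n} (x y : Subset n) → Dec (x ≡ y)
_≟S_ = ≡-dec _≟B_

shatters? : ∀ {n} (𝓕 : Family n) (A : Subset n) → Dec (Shatters 𝓕 A)
shatters? 𝓕 A with anySubset? (λ A' → (A' ⊆? A) ×-dec ¬? (any? (λ F → (F ∩ A) ≟S A') 𝓕))
... | yes (A' , A'⊆A , ¬any) = no (λ sh → ¬any (sh A' A'⊆A))
... | no ¬ex = yes λ A' A'⊆A → decide A' A'⊆A
  where
  decide : ∀ A' → A' ⊆ A → Any (λ F → F ∩ A ≡ A') 𝓕
  decide A' p with any? (λ F → (F ∩ A) ≟S A') 𝓕
  ... | yes q = q
  ... | no ¬q = Data.Empty.⊥-elim (¬ex (A' , p , ¬q))
    where import Data.Empty

allSubsets : (n : ℕ) → List (Subset n)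
allSubsets zero = [ Vec.[] ]
allSubsets (suc n) = map (false Vec.∷_) (allSubsets n) ++ map (true Vec.∷_) (allSubsets n)

-- All families given as lists of length ≤ k of subsets of [n]
-- (every family with at most k members arises this way).
families : (n k : ℕ) → List (Family n)
families n zero = [ [] ]
families n (suc k) = [] ∷ concatMap (λ S → map (S ∷_) (families n k)) (allSubsets n)

shatteredCount : ∀ {n} → Family n → ℕ → ℕ
shatteredCount {n} 𝓕 d =
  length (filter (λ A → (∣ A ∣ ≟ℕ d) ×-dec shatters? 𝓕 A) (allSubsets n))

-- f(n,k,d): maximum number of d-subsets of [n] shattered by a family of
-- at most k subsets of [n].
f : ℕ → ℕ → ℕ → ℕ
f n k d = foldr _⊔_ 0 (map (λ 𝓕 → shatteredCount 𝓕 d) (families n k))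

-- Regard n ^ d as the number of words t ∈ [n]^d, and call t good for 𝓕 when its entries
-- are distinct and 𝓕 shatters the set of its entries. Every d-set is enumerated by exactly
-- d! words, so n ^ d − d! · #(d-sets shattered by 𝓕) is the number of bad words. Take
-- families 𝓕₁, 𝓕₂ attaining f(n₁,k₁,d) and f(n₂,k₂,d), identify [n₁n₂] with [n₁] × [n₂],
-- and pull both back along the two projections: at most k₁ + k₂ sets. A word over [n₁n₂]
-- is good for this family as soon as one of its two projections is good (distinctness
-- reflects along maps, and a pulled-back set cuts out on a word the pattern the original
-- set cuts out on its projection), so its bad words lie among the pairs of bad words.

module Submission where

module Counting where

  open import Defs
  open import Algebra.Bundles using (CommutativeMonoid)
  open import Data.Bool using (Bool; true; false; _∧_; not; T)
  open import Data.Bool.Properties using (∧-zeroʳ; ∧-identityʳ; ∧-commutativeMonoid)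
  open import Data.Empty using (⊥-elim)
  open import Data.Fin using (Fin; zero; suc; _↑ˡ_; _↑ʳ_; combine; remQuot)
  open import Data.Fin.Properties using (remQuot-combine) renaming (_≟_ to _≟ᶠ_)
  open import Data.Fin.Subset using (Subset; inside; outside; ⊥; _∈_; _∉_; _⊆_; _∩_; ∣_∣)
  open import Data.Fin.Subset.Properties using (_∈?_; ∉⊥; ⊆-antisym; p∩q⊆q)
  open import Data.List using (List; []; _∷_; _++_; map; length; filter)
  open import Data.List.Properties
    using (map-++; map-∘; map-cong; length-++; length-map; foldr-preservesᵒ)
  open import Data.List.Membership.Propositional using (find; lose) renaming (_∈_ to _∈ˡ_)
  open import Data.List.Membership.Propositional.Properties
    using (∈-map⁺; ∈-map⁻; ∈-++⁺ˡ; ∈-++⁺ʳ; ∈-concatMap⁺; ∈-concatMap⁻; foldr-selective)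
  open import Data.List.Relation.Unary.Any as Any using (Any; here; there)
  open import Data.Nat using (ℕ; zero; suc; _+_; _*_; _^_; _≤_; _!; z≤n; s≤s)
  open import Data.Nat.ListAction using () renaming (sum to sumˡ)
  open import Data.Nat.ListAction.Properties using (sum-++)
  open import Data.Nat.Properties
    using ( _≟_; +-assoc; +-identityʳ; *-comm; *-assoc; *-identityˡ; *-identityʳ; *-zeroʳ
          ; *-distribˡ-+; +-mono-≤; ≤-refl; ≤-reflexive; ≤-trans; n≤0⇒n≡0
          ; ⊔-sel; m≤n⇒m≤n⊔o; m≤n⇒m≤o⊔n; +-*-semiring )
  open import Data.Product using (_×_; _,_; ∃-syntax; proj₁; proj₂)
  open import Data.Sum using (_⊎_; inj₁; inj₂; [_,_])
  open import Data.Vec as Vec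
    using (Vec; []; _∷_; lookup; tabulate; zipWith; _[_]≔_; here; there)
  open import Data.Vec.Properties as Vecₚ
    using ( []≔-updates; []≔-minimal; []≔-idempotent; []≔-lookup; []=-injective
          ; []=⇒lookup; lookup⇒[]=; lookup∘update; lookup∘update′; lookup-zipWith; lookup∘tabulate )
  open import Function using (_∘_; _⇔_; mk⇔)
  open import Relation.Nullary using (Dec; yes; no; does)
  open import Relation.Nullary.Decidable using (_×-dec_; T?; dec-false; does-⇔)
  open import Relation.Unary using (Pred; Decidable)
  open import Relation.Binary.PropositionalEquality
    using (_≡_; refl; sym; trans; cong; cong₂; subst; module ≡-Reasoning)
  open import Algebra.Properties.Semiring.Sum +-*-semiring
    using (sum-syntax; sum-cong-≗; ∑-comm; ∑-distrib-+; *-distribˡ-sum; *-distribʳ-sum)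
  open import Algebra.Properties.CommutativeSemigroup
    (CommutativeMonoid.commutativeSemigroup ∧-commutativeMonoid) using (x∙yz≈y∙xz)
  open ≡-Reasoning

  ∑-mono-≤ : ∀ {n} {g h : Fin n → ℕ} → (∀ i → g i ≤ h i) → ∑[ i < n ] g i ≤ ∑[ i < n ] h i
  ∑-mono-≤ {zero}  g≤h = z≤n
  ∑-mono-≤ {suc n} g≤h = +-mono-≤ (g≤h zero) (∑-mono-≤ (g≤h ∘ suc))

  ∑-const : ∀ n c → ∑[ i < n ] c ≡ n * c
  ∑-const zero    c = refl
  ∑-const (suc n) c = cong (c +_) (∑-const n c)

  ∑-split : ∀ m n (g : Fin (m + n) → ℕ) →
    ∑[ z < m + n ] g z ≡ ∑[ i < m ] g (i ↑ˡ n) + ∑[ j < n ] g (m ↑ʳ j)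
  ∑-split zero    n g = refl
  ∑-split (suc m) n g = trans (cong (g zero +_) (∑-split m n (g ∘ suc))) (sym (+-assoc (g zero) _ _))

  ∑-combine : ∀ m n (g : Fin (m * n) → ℕ) →
    ∑[ z < m * n ] g z ≡ ∑[ i < m ] ∑[ j < n ] g (combine i j)
  ∑-combine zero    n g = refl
  ∑-combine (suc m) n g = trans
    (∑-split n (m * n) g)
    (cong (∑[ j < n ] g (j ↑ˡ m * n) +_) (∑-combine m n (g ∘ (n ↑ʳ_))))

  ∑ˡ : ∀ {a} {A : Set a} → List A → (A → ℕ) → ℕ
  ∑ˡ xs g = sumˡ (map g xs)

  module _ {a} {A : Set a} where

    ∑ˡ-cong : ∀ (xs : List A) {g h : A → ℕ} → (∀ x → g x ≡ h x) → ∑ˡ xs g ≡ ∑ˡ xs h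
    ∑ˡ-cong xs g≗h = cong sumˡ (map-cong g≗h xs)

    ∑ˡ-zero : ∀ (xs : List A) → ∑ˡ xs (λ _ → 0) ≡ 0
    ∑ˡ-zero []       = refl
    ∑ˡ-zero (x ∷ xs) = ∑ˡ-zero xs

    *-distribˡ-∑ˡ : ∀ c (xs : List A) (g : A → ℕ) → c * ∑ˡ xs g ≡ ∑ˡ xs (λ x → c * g x)
    *-distribˡ-∑ˡ c []       g = *-zeroʳ c
    *-distribˡ-∑ˡ c (x ∷ xs) g =
      trans (*-distribˡ-+ c (g x) _) (cong (c * g x +_) (*-distribˡ-∑ˡ c xs g))

  ∑ᵛ : ∀ n d → (Vec (Fin n) d → ℕ) → ℕ
  ∑ᵛ n zero    h = h []
  ∑ᵛ n (suc d) h = ∑[ x < n ] ∑ᵛ n d (h ∘ (x ∷_))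

  module _ {n : ℕ} where

    ∑ᵛ-cong : ∀ d {g h : Vec (Fin n) d → ℕ} → (∀ t → g t ≡ h t) → ∑ᵛ n d g ≡ ∑ᵛ n d h
    ∑ᵛ-cong zero    g≗h = g≗h []
    ∑ᵛ-cong (suc d) g≗h = sum-cong-≗ (λ x → ∑ᵛ-cong d (g≗h ∘ (x ∷_)))

    ∑ᵛ-mono-≤ : ∀ d {g h : Vec (Fin n) d → ℕ} → (∀ t → g t ≤ h t) → ∑ᵛ n d g ≤ ∑ᵛ n d h
    ∑ᵛ-mono-≤ zero    g≤h = g≤h []
    ∑ᵛ-mono-≤ (suc d) g≤h = ∑-mono-≤ (λ x → ∑ᵛ-mono-≤ d (g≤h ∘ (x ∷_)))

    ∑ᵛ-distrib-+ : ∀ d (g h : Vec (Fin n) d → ℕ) →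
      ∑ᵛ n d (λ t → g t + h t) ≡ ∑ᵛ n d g + ∑ᵛ n d h
    ∑ᵛ-distrib-+ zero    g h = refl
    ∑ᵛ-distrib-+ (suc d) g h = trans
      (sum-cong-≗ {n} (λ x → ∑ᵛ-distrib-+ d (g ∘ (x ∷_)) (h ∘ (x ∷_))))
      (∑-distrib-+ (λ x → ∑ᵛ n d (g ∘ (x ∷_))) (λ x → ∑ᵛ n d (h ∘ (x ∷_))))

    *-distribˡ-∑ᵛ : ∀ d c (h : Vec (Fin n) d → ℕ) → c * ∑ᵛ n d h ≡ ∑ᵛ n d (λ t → c * h t)
    *-distribˡ-∑ᵛ zero    c h = refl
    *-distribˡ-∑ᵛ (suc d) c h = trans
      (*-distribˡ-sum c (λ x → ∑ᵛ n d (h ∘ (x ∷_))))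
      (sum-cong-≗ {n} (λ x → *-distribˡ-∑ᵛ d c (h ∘ (x ∷_))))

    *-distribʳ-∑ᵛ : ∀ d c (h : Vec (Fin n) d → ℕ) → ∑ᵛ n d h * c ≡ ∑ᵛ n d (λ t → h t * c)
    *-distribʳ-∑ᵛ d c h = begin
      ∑ᵛ n d h * c            ≡⟨ *-comm _ c ⟩
      c * ∑ᵛ n d h            ≡⟨ *-distribˡ-∑ᵛ d c h ⟩
      ∑ᵛ n d (λ t → c * h t)  ≡⟨ ∑ᵛ-cong d (λ t → *-comm c (h t)) ⟩
      ∑ᵛ n d (λ t → h t * c)  ∎

    ∑ᵛ-const : ∀ d c → ∑ᵛ n d (λ _ → c) ≡ n ^ d * c
    ∑ᵛ-const zero    c = sym (*-identityˡ c)
    ∑ᵛ-const (suc d) c = begin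
      ∑[ x < n ] ∑ᵛ n d (λ _ → c)  ≡⟨ sum-cong-≗ {n} (λ _ → ∑ᵛ-const d c) ⟩
      ∑[ x < n ] (n ^ d * c)       ≡⟨ ∑-const n (n ^ d * c) ⟩
      n * (n ^ d * c)              ≡⟨ *-assoc n (n ^ d) c ⟨
      n ^ suc d * c                ∎

    ∑-∑ᵛ-comm : ∀ {k} d (g : Fin k → Vec (Fin n) d → ℕ) →
      ∑[ j < k ] ∑ᵛ n d (g j) ≡ ∑ᵛ n d (λ t → ∑[ j < k ] g j t)
    ∑-∑ᵛ-comm zero    g = refl
    ∑-∑ᵛ-comm (suc d) g = trans
      (∑-comm (λ j x → ∑ᵛ n d (g j ∘ (x ∷_))))
      (sum-cong-≗ (λ x → ∑-∑ᵛ-comm d (λ j → g j ∘ (x ∷_))))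

    ∑ᵛ-∑ˡ-comm : ∀ {a} {A : Set a} d (xs : List A) (k : Vec (Fin n) d → A → ℕ) →
      ∑ᵛ n d (λ t → ∑ˡ xs (k t)) ≡ ∑ˡ xs (λ x → ∑ᵛ n d (λ t → k t x))
    ∑ᵛ-∑ˡ-comm d []       k = trans (∑ᵛ-const d 0) (*-zeroʳ (n ^ d))
    ∑ᵛ-∑ˡ-comm d (x ∷ xs) k = trans
      (∑ᵛ-distrib-+ d (λ t → k t x) (λ t → ∑ˡ xs (k t)))
      (cong (∑ᵛ n d (λ t → k t x) +_) (∑ᵛ-∑ˡ-comm d xs k))

  ∑ᵛ-*-∑ᵛ : ∀ m n d (a : Vec (Fin m) d → ℕ) (b : Vec (Fin n) d → ℕ) →
    ∑ᵛ m d (λ s → ∑ᵛ n d (λ t → a s * b t)) ≡ ∑ᵛ m d a * ∑ᵛ n d b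
  ∑ᵛ-*-∑ᵛ m n d a b = begin
    ∑ᵛ m d (λ s → ∑ᵛ n d (λ t → a s * b t))  ≡⟨ ∑ᵛ-cong d (λ s → *-distribˡ-∑ᵛ d (a s) b) ⟨
    ∑ᵛ m d (λ s → a s * ∑ᵛ n d b)            ≡⟨ *-distribʳ-∑ᵛ d (∑ᵛ n d b) a ⟨
    ∑ᵛ m d a * ∑ᵛ n d b                      ∎

  ∑ᵛ-combine : ∀ m n d (h : Vec (Fin (m * n)) d → ℕ) →
    ∑ᵛ (m * n) d h ≡ ∑ᵛ m d (λ s → ∑ᵛ n d (λ t → h (zipWith combine s t)))
  ∑ᵛ-combine m n zero    h = refl
  ∑ᵛ-combine m n (suc d) h = begin
    ∑[ z < m * n ] ∑ᵛ (m * n) d (h ∘ (z ∷_))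
      ≡⟨ ∑-combine m n _ ⟩
    ∑[ i < m ] ∑[ j < n ] ∑ᵛ (m * n) d (h ∘ (combine i j ∷_))
      ≡⟨ sum-cong-≗ {m} (λ i → sum-cong-≗ {n} (λ j → ∑ᵛ-combine m n d _)) ⟩
    ∑[ i < m ] ∑[ j < n ] ∑ᵛ m d (λ s → ∑ᵛ n d (λ t → h (combine i j ∷ zipWith combine s t)))
      ≡⟨ sum-cong-≗ {m} (λ i → ∑-∑ᵛ-comm d (λ j s → ∑ᵛ n d (λ t → h (combine i j ∷ zipWith combine s t)))) ⟩
    ∑[ i < m ] ∑ᵛ m d (λ s → ∑[ j < n ] ∑ᵛ n d (λ t → h (combine i j ∷ zipWith combine s t)))
      ∎

  ⟦_⟧ : Bool → ℕ
  ⟦ true  ⟧ = 1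
  ⟦ false ⟧ = 0

  ⟦∧⟧ : ∀ a b → ⟦ a ∧ b ⟧ ≡ ⟦ a ⟧ * ⟦ b ⟧
  ⟦∧⟧ true  b = sym (*-identityˡ ⟦ b ⟧)
  ⟦∧⟧ false b = refl

  ⟦⟧+⟦not⟧ : ∀ b → ⟦ b ⟧ + ⟦ not b ⟧ ≡ 1
  ⟦⟧+⟦not⟧ true  = refl
  ⟦⟧+⟦not⟧ false = refl

  ⟦not⟧-≤-* : ∀ {a b c} {A : Set a} {B : Set b} {C : Set c} (A? : Dec A) (B? : Dec B) (C? : Dec C) →
    (A → C) → (B → C) → ⟦ not (does C?) ⟧ ≤ ⟦ not (does A?) ⟧ * ⟦ not (does B?) ⟧
  ⟦not⟧-≤-* _       _       (yes _) _   _   = z≤n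
  ⟦not⟧-≤-* (yes a) _       (no ¬c) A⇒C _   = ⊥-elim (¬c (A⇒C a))
  ⟦not⟧-≤-* (no _)  (yes b) (no ¬c) _   B⇒C = ⊥-elim (¬c (B⇒C b))
  ⟦not⟧-≤-* (no _)  (no _)  (no _)  _   _   = ≤-refl

  length-filter≡∑ˡ : ∀ {a p} {A : Set a} {P : Pred A p} (P? : Decidable P) xs →
    length (filter P? xs) ≡ ∑ˡ xs (λ x → ⟦ does (P? x) ⟧)
  length-filter≡∑ˡ P? []       = refl
  length-filter≡∑ˡ P? (x ∷ xs) with does (P? x)
  ... | true  = cong suc (length-filter≡∑ˡ P? xs)
  ... | false = length-filter≡∑ˡ P? xs

  ∑ˡ-allSubsets-suc : ∀ n (g : Subset (suc n) → ℕ) →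
    ∑ˡ (allSubsets (suc n)) g ≡ ∑ˡ (allSubsets n) (g ∘ (outside ∷_)) + ∑ˡ (allSubsets n) (g ∘ (inside ∷_))
  ∑ˡ-allSubsets-suc n g = begin
    sumˡ (map g (map (outside ∷_) S ++ map (inside ∷_) S))
      ≡⟨ cong sumˡ (map-++ g (map (outside ∷_) S) _) ⟩
    sumˡ (map g (map (outside ∷_) S) ++ map g (map (inside ∷_) S))
      ≡⟨ sum-++ (map g (map (outside ∷_) S)) _ ⟩
    sumˡ (map g (map (outside ∷_) S)) + sumˡ (map g (map (inside ∷_) S))
      ≡⟨ cong₂ _+_ (cong sumˡ (map-∘ S)) (cong sumˡ (map-∘ S)) ⟨
    ∑ˡ S (g ∘ (outside ∷_)) + ∑ˡ S (g ∘ (inside ∷_))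
      ∎
    where S = allSubsets n

  ∑ˡ-allSubsets-select : ∀ {n} (u : Subset n) (g : Subset n → ℕ) →
    ∑ˡ (allSubsets n) (λ A → ⟦ does (u ≟S A) ⟧ * g A) ≡ g u
  ∑ˡ-allSubsets-select []                    g = trans (+-identityʳ _) (*-identityˡ (g []))
  ∑ˡ-allSubsets-select {suc n} (outside ∷ u) g = begin
    ∑ˡ (allSubsets (suc n)) (λ A → ⟦ does ((outside ∷ u) ≟S A) ⟧ * g A)
      ≡⟨ ∑ˡ-allSubsets-suc n _ ⟩
    ∑ˡ (allSubsets n) (λ A → ⟦ does (u ≟S A) ⟧ * g (outside ∷ A)) + ∑ˡ (allSubsets n) (λ _ → 0)
      ≡⟨ cong₂ _+_ (∑ˡ-allSubsets-select u (g ∘ (outside ∷_))) (∑ˡ-zero (allSubsets n)) ⟩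
    g (outside ∷ u) + 0
      ≡⟨ +-identityʳ _ ⟩
    g (outside ∷ u)
      ∎
  ∑ˡ-allSubsets-select {suc n} (inside ∷ u)  g = trans
    (∑ˡ-allSubsets-suc n _)
    (cong₂ _+_ (∑ˡ-zero (allSubsets n)) (∑ˡ-allSubsets-select u (g ∘ (inside ∷_))))

  ∑-⟦∈⟧ : ∀ {n} (A : Subset n) → ∑[ x < n ] ⟦ does (x ∈? A) ⟧ ≡ ∣ A ∣
  ∑-⟦∈⟧ []            = refl
  ∑-⟦∈⟧ (inside ∷ A)  = cong suc (∑-⟦∈⟧ A)
  ∑-⟦∈⟧ (outside ∷ A) = ∑-⟦∈⟧ A

  suc-∣[]≔outside∣ : ∀ {n} {A : Subset n} {x} → x ∈ A → suc ∣ A [ x ]≔ outside ∣ ≡ ∣ A ∣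
  suc-∣[]≔outside∣ {A = inside ∷ A}  here      = refl
  suc-∣[]≔outside∣ {A = inside ∷ A}  (there p) = cong suc (suc-∣[]≔outside∣ p)
  suc-∣[]≔outside∣ {A = outside ∷ A} (there p) = suc-∣[]≔outside∣ p

  does-⊥≟S : ∀ {n} (A : Subset n) → does (⊥ ≟S A) ≡ does (∣ A ∣ ≟ 0)
  does-⊥≟S []            = refl
  does-⊥≟S (inside ∷ A)  = refl
  does-⊥≟S (outside ∷ A) = does-⊥≟S A

  module _ {n : ℕ} where

    ∈-[]≔inside⁺ : ∀ {x y} {B : Subset n} → y ∈ B → y ∈ B [ x ]≔ inside
    ∈-[]≔inside⁺ {x} {y} {B} y∈B with y ≟ᶠ x
    ... | yes refl = []≔-updates B y
    ... | no y≢x   = []≔-minimal B y x y≢x y∈B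

    ∈-[]≔inside⁻ : ∀ {x y} {B : Subset n} → y ∈ B [ x ]≔ inside → y ≡ x ⊎ y ∈ B
    ∈-[]≔inside⁻ {x} {y} {B} y∈ with y ≟ᶠ x
    ... | yes y≡x = inj₁ y≡x
    ... | no y≢x  = inj₂ (lookup⇒[]= y B (trans (sym (lookup∘update′ y≢x B inside)) ([]=⇒lookup y∈)))

    ∉-[]≔outside : ∀ x (A : Subset n) → x ∉ A [ x ]≔ outside
    ∉-[]≔outside x A x∈ with []=-injective x∈ ([]≔-updates A x)
    ... | ()

    ∉⇒lookup≡outside : ∀ {x} {B : Subset n} → x ∉ B → lookup B x ≡ outside
    ∉⇒lookup≡outside {x} {B} x∉B with lookup B x in eq
    ... | inside  = ⊥-elim (x∉B (lookup⇒[]= x B eq))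
    ... | outside = refl

    []≔inside≡⇔ : ∀ {x} {A B : Subset n} → x ∉ B →
      B [ x ]≔ inside ≡ A ⇔ (x ∈ A × B ≡ A [ x ]≔ outside)
    []≔inside≡⇔ {x} {A} {B} x∉B = mk⇔ to from
      where
      to : B [ x ]≔ inside ≡ A → x ∈ A × B ≡ A [ x ]≔ outside
      to refl = []≔-updates B x , (begin
        B                               ≡⟨ []≔-lookup B x ⟨
        B [ x ]≔ lookup B x             ≡⟨ cong (B [ x ]≔_) (∉⇒lookup≡outside x∉B) ⟩
        B [ x ]≔ outside                ≡⟨ []≔-idempotent B x ⟨
        B [ x ]≔ inside [ x ]≔ outside  ∎)
      from : x ∈ A × B ≡ A [ x ]≔ outside → B [ x ]≔ inside ≡ A
      from (x∈A , refl) = begin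
        A [ x ]≔ outside [ x ]≔ inside  ≡⟨ []≔-idempotent A x ⟩
        A [ x ]≔ inside                 ≡⟨ cong (A [ x ]≔_) ([]=⇒lookup x∈A) ⟨
        A [ x ]≔ lookup A x             ≡⟨ []≔-lookup A x ⟩
        A                               ∎

  -- Words and the sets they enumerate

  module _ {n : ℕ} where

    img : ∀ {d} → Vec (Fin n) d → Subset n
    img []      = ⊥
    img (x ∷ t) = img t [ x ]≔ inside

    distinct : ∀ {d} → Vec (Fin n) d → Bool
    distinct []      = true
    distinct (x ∷ t) = not (does (x ∈? img t)) ∧ distinct t

    enumerates : ∀ {d} → Vec (Fin n) d → Subset n → Bool
    enumerates t A = distinct t ∧ does (img t ≟S A)

    enumerates-∷ : ∀ {d} x (t : Vec (Fin n) d) A →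
      enumerates (x ∷ t) A ≡ does (x ∈? A) ∧ enumerates t (A [ x ]≔ outside)
    enumerates-∷ x t A with x ∈? img t
    ... | yes x∈t
      rewrite dec-false (img t ≟S (A [ x ]≔ outside)) (λ img≡ → ∉-[]≔outside x A (subst (x ∈_) img≡ x∈t))
      = sym (trans (cong (does (x ∈? A) ∧_) (∧-zeroʳ (distinct t))) (∧-zeroʳ _))
    ... | no x∉t = begin
      distinct t ∧ does ((img t [ x ]≔ inside) ≟S A)
        ≡⟨ cong (distinct t ∧_) (does-⇔ ([]≔inside≡⇔ x∉t)
             ((img t [ x ]≔ inside) ≟S A) (x ∈? A ×-dec img t ≟S (A [ x ]≔ outside))) ⟩
      distinct t ∧ (does (x ∈? A) ∧ does (img t ≟S (A [ x ]≔ outside)))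
        ≡⟨ x∙yz≈y∙xz (distinct t) (does (x ∈? A)) (does (img t ≟S (A [ x ]≔ outside))) ⟩
      does (x ∈? A) ∧ enumerates t (A [ x ]≔ outside)
        ∎

  ∑ᵛ-enumerates : ∀ n d (A : Subset n) →
    ∑ᵛ n d (λ t → ⟦ enumerates t A ⟧) ≡ ⟦ does (∣ A ∣ ≟ d) ⟧ * d !
  ∑ᵛ-enumerates n zero    A = trans (cong ⟦_⟧ (does-⊥≟S A)) (sym (*-identityʳ _))
  ∑ᵛ-enumerates n (suc d) A = begin
    ∑[ x < n ] ∑ᵛ n d (λ t → ⟦ enumerates (x ∷ t) A ⟧)
      ≡⟨ sum-cong-≗ {n} (λ x → ∑ᵛ-cong d (λ t →
           trans (cong ⟦_⟧ (enumerates-∷ x t A)) (⟦∧⟧ (does (x ∈? A)) _))) ⟩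
    ∑[ x < n ] ∑ᵛ n d (λ t → ⟦ does (x ∈? A) ⟧ * ⟦ enumerates t (A [ x ]≔ outside) ⟧)
      ≡⟨ sum-cong-≗ {n} (λ x → *-distribˡ-∑ᵛ d ⟦ does (x ∈? A) ⟧ _) ⟨
    ∑[ x < n ] (⟦ does (x ∈? A) ⟧ * ∑ᵛ n d (λ t → ⟦ enumerates t (A [ x ]≔ outside) ⟧))
      ≡⟨ sum-cong-≗ {n} (λ x → cong (⟦ does (x ∈? A) ⟧ *_) (∑ᵛ-enumerates n d (A [ x ]≔ outside))) ⟩
    ∑[ x < n ] (⟦ does (x ∈? A) ⟧ * (⟦ does (∣ A [ x ]≔ outside ∣ ≟ d) ⟧ * d !))
      ≡⟨ sum-cong-≗ {n} remove-x ⟩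
    ∑[ x < n ] (⟦ does (x ∈? A) ⟧ * (⟦ does (∣ A ∣ ≟ suc d) ⟧ * d !))
      ≡⟨ *-distribʳ-sum _ (λ x → ⟦ does (x ∈? A) ⟧) ⟨
    (∑[ x < n ] ⟦ does (x ∈? A) ⟧) * (⟦ does (∣ A ∣ ≟ suc d) ⟧ * d !)
      ≡⟨ cong (_* (⟦ does (∣ A ∣ ≟ suc d) ⟧ * d !)) (∑-⟦∈⟧ A) ⟩
    ∣ A ∣ * (⟦ does (∣ A ∣ ≟ suc d) ⟧ * d !)
      ≡⟨ m*d!≡suc-d! (∣ A ∣ ≟ suc d) ⟩
    ⟦ does (∣ A ∣ ≟ suc d) ⟧ * suc d !
      ∎
    where
    remove-x : ∀ x → ⟦ does (x ∈? A) ⟧ * (⟦ does (∣ A [ x ]≔ outside ∣ ≟ d) ⟧ * d !)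
                   ≡ ⟦ does (x ∈? A) ⟧ * (⟦ does (∣ A ∣ ≟ suc d) ⟧ * d !)
    remove-x x with x ∈? A
    ... | yes x∈A = cong (λ m → 1 * (⟦ does (m ≟ suc d) ⟧ * d !)) (suc-∣[]≔outside∣ x∈A)
    ... | no _    = refl
    m*d!≡suc-d! : ∀ {m} (m≟ : Dec (m ≡ suc d)) → m * (⟦ does m≟ ⟧ * d !) ≡ ⟦ does m≟ ⟧ * suc d !
    m*d!≡suc-d! {m} (yes refl) = trans (cong (m *_) (*-identityˡ (d !))) (sym (*-identityˡ _))
    m*d!≡suc-d! {m} (no _)     = *-zeroʳ m

  ∑ˡ-enumerates : ∀ {n d} (t : Vec (Fin n) d) (h : Subset n → ℕ) →
    ∑ˡ (allSubsets n) (λ A → ⟦ enumerates t A ⟧ * h A) ≡ ⟦ distinct t ⟧ * h (img t)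
  ∑ˡ-enumerates {n} t h = begin
    ∑ˡ (allSubsets n) (λ A → ⟦ enumerates t A ⟧ * h A)
      ≡⟨ ∑ˡ-cong (allSubsets n) (λ A → cong (_* h A) (⟦∧⟧ (distinct t) _)) ⟩
    ∑ˡ (allSubsets n) (λ A → ⟦ distinct t ⟧ * ⟦ does (img t ≟S A) ⟧ * h A)
      ≡⟨ ∑ˡ-cong (allSubsets n) (λ A → *-assoc ⟦ distinct t ⟧ ⟦ does (img t ≟S A) ⟧ (h A)) ⟩
    ∑ˡ (allSubsets n) (λ A → ⟦ distinct t ⟧ * (⟦ does (img t ≟S A) ⟧ * h A))
      ≡⟨ *-distribˡ-∑ˡ ⟦ distinct t ⟧ (allSubsets n) _ ⟨
    ⟦ distinct t ⟧ * ∑ˡ (allSubsets n) (λ A → ⟦ does (img t ≟S A) ⟧ * h A)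
      ≡⟨ cong (⟦ distinct t ⟧ *_) (∑ˡ-allSubsets-select (img t) h) ⟩
    ⟦ distinct t ⟧ * h (img t)
      ∎

  ∑ᵛ-distinct-img : ∀ n d (h : Subset n → ℕ) →
    ∑ᵛ n d (λ t → ⟦ distinct t ⟧ * h (img t))
      ≡ d ! * ∑ˡ (allSubsets n) (λ A → ⟦ does (∣ A ∣ ≟ d) ⟧ * h A)
  ∑ᵛ-distinct-img n d h = begin
    ∑ᵛ n d (λ t → ⟦ distinct t ⟧ * h (img t))
      ≡⟨ ∑ᵛ-cong d (λ t → ∑ˡ-enumerates t h) ⟨
    ∑ᵛ n d (λ t → ∑ˡ S (λ A → ⟦ enumerates t A ⟧ * h A))
      ≡⟨ ∑ᵛ-∑ˡ-comm d S (λ t A → ⟦ enumerates t A ⟧ * h A) ⟩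
    ∑ˡ S (λ A → ∑ᵛ n d (λ t → ⟦ enumerates t A ⟧ * h A))
      ≡⟨ ∑ˡ-cong S (λ A → *-distribʳ-∑ᵛ d (h A) (λ t → ⟦ enumerates t A ⟧)) ⟨
    ∑ˡ S (λ A → ∑ᵛ n d (λ t → ⟦ enumerates t A ⟧) * h A)
      ≡⟨ ∑ˡ-cong S (λ A → cong (_* h A) (∑ᵛ-enumerates n d A)) ⟩
    ∑ˡ S (λ A → ⟦ does (∣ A ∣ ≟ d) ⟧ * d ! * h A)
      ≡⟨ ∑ˡ-cong S (λ A →
           trans (cong (_* h A) (*-comm ⟦ does (∣ A ∣ ≟ d) ⟧ (d !))) (*-assoc (d !) _ (h A))) ⟩
    ∑ˡ S (λ A → d ! * (⟦ does (∣ A ∣ ≟ d) ⟧ * h A))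
      ≡⟨ *-distribˡ-∑ˡ (d !) S _ ⟨
    d ! * ∑ˡ S (λ A → ⟦ does (∣ A ∣ ≟ d) ⟧ * h A)
      ∎
    where S = allSubsets n

  -- Traces and shattering

  module _ {n : ℕ} where

    trace : ∀ {d} → Subset n → Vec (Fin n) d → Vec Bool d
    trace S t = Vec.map (lookup S) t

    map-cong-img : ∀ {d} {a} {B : Set a} {g h : Fin n → B} (t : Vec (Fin n) d) →
      (∀ {y} → y ∈ img t → g y ≡ h y) → Vec.map g t ≡ Vec.map h t
    map-cong-img []      g≗h = refl
    map-cong-img (x ∷ t) g≗h =
      cong₂ _∷_ (g≗h ([]≔-updates (img t) x)) (map-cong-img t (g≗h ∘ ∈-[]≔inside⁺))

    map-≡⇒≗-img : ∀ {d} {a} {B : Set a} {g h : Fin n → B} (t : Vec (Fin n) d) →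
      Vec.map g t ≡ Vec.map h t → ∀ {y} → y ∈ img t → g y ≡ h y
    map-≡⇒≗-img []      _   y∈ = ⊥-elim (∉⊥ y∈)
    map-≡⇒≗-img (x ∷ t) g≡h y∈ with ∈-[]≔inside⁻ y∈
    ... | inj₁ refl = cong Vec.head g≡h
    ... | inj₂ y∈t  = map-≡⇒≗-img t (cong Vec.tail g≡h) y∈t

    trace-∩-img : ∀ {d} (S : Subset n) (t : Vec (Fin n) d) → trace (S ∩ img t) t ≡ trace S t
    trace-∩-img S t = map-cong-img t λ {y} y∈ → begin
      lookup (S ∩ img t) y           ≡⟨ lookup-zipWith _∧_ y S (img t) ⟩
      lookup S y ∧ lookup (img t) y  ≡⟨ cong (lookup S y ∧_) ([]=⇒lookup y∈) ⟩
      lookup S y ∧ true              ≡⟨ ∧-identityʳ (lookup S y) ⟩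
      lookup S y                     ∎

    trace-injective : ∀ {d} {P Q : Subset n} (t : Vec (Fin n) d) →
      P ⊆ img t → Q ⊆ img t → trace P t ≡ trace Q t → P ≡ Q
    trace-injective t P⊆ Q⊆ trP≡trQ = ⊆-antisym (⊆-by P⊆ trP≡trQ) (⊆-by Q⊆ (sym trP≡trQ))
      where
      ⊆-by : ∀ {P Q} → P ⊆ img t → trace P t ≡ trace Q t → P ⊆ Q
      ⊆-by {P} {Q} P⊆ trP≡trQ {y} y∈P =
        lookup⇒[]= y Q (trans (sym (map-≡⇒≗-img t trP≡trQ (P⊆ y∈P))) ([]=⇒lookup y∈P))

    trace-surjective : ∀ {d} (t : Vec (Fin n) d) → T (distinct t) →
      ∀ b → ∃[ A ] A ⊆ img t × trace A t ≡ b
    trace-surjective []      _           []      = ⊥ , (λ y∈⊥ → ⊥-elim (∉⊥ y∈⊥)) , refl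
    trace-surjective (x ∷ t) distinct-xt (c ∷ b) with x ∈? img t
    ... | yes _  = ⊥-elim distinct-xt
    ... | no x∉t =
      let A , A⊆ , trA≡b = trace-surjective t distinct-xt b in
      A [ x ]≔ c , []≔-⊆ A⊆ , cong₂ _∷_ (lookup∘update x A c) (trans (trace-[]≔ A) trA≡b)
      where
      []≔-⊆ : ∀ {A} → A ⊆ img t → A [ x ]≔ c ⊆ img t [ x ]≔ inside
      []≔-⊆ {A} A⊆ {y} y∈ with y ≟ᶠ x
      ... | yes refl = []≔-updates (img t) y
      ... | no y≢x   =
        ∈-[]≔inside⁺ (A⊆ (lookup⇒[]= y A (trans (sym (lookup∘update′ y≢x A c)) ([]=⇒lookup y∈))))
      trace-[]≔ : ∀ A → trace (A [ x ]≔ c) t ≡ trace A t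
      trace-[]≔ A = map-cong-img t λ y∈t → lookup∘update′ (λ { refl → x∉t y∈t }) A c

  ShattersWord : ∀ {n d} → Family n → Vec (Fin n) d → Set
  ShattersWord 𝓕 t = ∀ b → Any (λ S → trace S t ≡ b) 𝓕

  module _ {n d : ℕ} {𝓕 : Family n} (t : Vec (Fin n) d) where

    shatters⇒shattersWord : T (distinct t) → Shatters 𝓕 (img t) → ShattersWord 𝓕 t
    shatters⇒shattersWord distinct-t sh b =
      let A , A⊆ , trA≡b = trace-surjective t distinct-t b in
      Any.map
        (λ {S} S∩t≡A → trans (sym (trace-∩-img S t)) (trans (cong (λ B → trace B t) S∩t≡A) trA≡b))
        (sh A A⊆)

    shattersWord⇒shatters : ShattersWord 𝓕 t → Shatters 𝓕 (img t)
    shattersWord⇒shatters sh A A⊆ =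
      Any.map
        (λ {S} trS≡trA → trace-injective t (p∩q⊆q S (img t)) A⊆ (trans (trace-∩-img S t) trS≡trA))
        (sh (trace A t))

  preimage : ∀ {m n} → (Fin m → Fin n) → Subset n → Subset m
  preimage π S = tabulate (lookup S ∘ π)

  module _ {m n : ℕ} (π : Fin m → Fin n) where

    trace-preimage : ∀ {d} S (u : Vec (Fin m) d) → trace (preimage π S) u ≡ trace S (Vec.map π u)
    trace-preimage S u =
      trans (Vecₚ.map-cong (lookup∘tabulate (lookup S ∘ π)) u) (Vecₚ.map-∘ (lookup S) π u)

    ∈-img-map : ∀ {d y} (u : Vec (Fin m) d) → y ∈ img u → π y ∈ img (Vec.map π u)
    ∈-img-map []      y∈ = ⊥-elim (∉⊥ y∈)
    ∈-img-map (z ∷ u) y∈ with ∈-[]≔inside⁻ y∈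
    ... | inj₁ refl = []≔-updates (img (Vec.map π u)) (π z)
    ... | inj₂ y∈u  = ∈-[]≔inside⁺ (∈-img-map u y∈u)

    distinct-map⁻ : ∀ {d} (u : Vec (Fin m) d) → T (distinct (Vec.map π u)) → T (distinct u)
    distinct-map⁻ []      _ = _
    distinct-map⁻ (z ∷ u) distinct-πzu with π z ∈? img (Vec.map π u) | z ∈? img u
    ... | yes _   | _       = ⊥-elim distinct-πzu
    ... | no πz∉  | yes z∈  = ⊥-elim (πz∉ (∈-img-map u z∈))
    ... | no _    | no _    = distinct-map⁻ u distinct-πzu

    shattersWord-preimage : ∀ {d} {𝓖 : Family n} {𝓗 : Family m} →
      (∀ {S} → S ∈ˡ 𝓖 → preimage π S ∈ˡ 𝓗) →
      (u : Vec (Fin m) d) → ShattersWord 𝓖 (Vec.map π u) → ShattersWord 𝓗 u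
    shattersWord-preimage preimage∈ u sh b =
      let S , S∈ , trS≡b = find (sh b) in
      lose (preimage∈ S∈) (trans (trace-preimage S u) trS≡b)

  -- Counting good words

  Good : ∀ {n d} → Family n → Vec (Fin n) d → Set
  Good 𝓕 t = T (distinct t) × Shatters 𝓕 (img t)

  good? : ∀ {n d} (𝓕 : Family n) (t : Vec (Fin n) d) → Dec (Good 𝓕 t)
  good? 𝓕 t = T? (distinct t) ×-dec shatters? 𝓕 (img t)

  good-preimage : ∀ {m n d} (π : Fin m → Fin n) {𝓖 : Family n} {𝓗 : Family m} →
    (∀ {S} → S ∈ˡ 𝓖 → preimage π S ∈ˡ 𝓗) →
    (u : Vec (Fin m) d) → Good 𝓖 (Vec.map π u) → Good 𝓗 u
  good-preimage π preimage∈ u (distinct-πu , sh) =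
    distinct-map⁻ π u distinct-πu ,
    shattersWord⇒shatters u
      (shattersWord-preimage π preimage∈ u (shatters⇒shattersWord (Vec.map π u) distinct-πu sh))

  ∑ᵛ-good : ∀ n d (𝓕 : Family n) →
    ∑ᵛ n d (λ t → ⟦ does (good? 𝓕 t) ⟧) ≡ d ! * shatteredCount 𝓕 d
  ∑ᵛ-good n d 𝓕 = begin
    ∑ᵛ n d (λ t → ⟦ distinct t ∧ does (shatters? 𝓕 (img t)) ⟧)
      ≡⟨ ∑ᵛ-cong d (λ t → ⟦∧⟧ (distinct t) _) ⟩
    ∑ᵛ n d (λ t → ⟦ distinct t ⟧ * ⟦ does (shatters? 𝓕 (img t)) ⟧)
      ≡⟨ ∑ᵛ-distinct-img n d (λ A → ⟦ does (shatters? 𝓕 A) ⟧) ⟩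
    d ! * ∑ˡ S (λ A → ⟦ does (∣ A ∣ ≟ d) ⟧ * ⟦ does (shatters? 𝓕 A) ⟧)
      ≡⟨ cong (d ! *_) (∑ˡ-cong S (λ A → ⟦∧⟧ (does (∣ A ∣ ≟ d)) _)) ⟨
    d ! * ∑ˡ S (λ A → ⟦ does ((∣ A ∣ ≟ d) ×-dec shatters? 𝓕 A) ⟧)
      ≡⟨ cong (d ! *_) (length-filter≡∑ˡ (λ A → (∣ A ∣ ≟ d) ×-dec shatters? 𝓕 A) S) ⟨
    d ! * shatteredCount 𝓕 d
      ∎
    where S = allSubsets n

  badCount : ∀ n d → Family n → ℕ
  badCount n d 𝓕 = ∑ᵛ n d (λ t → ⟦ not (does (good? 𝓕 t)) ⟧)

  shattered+bad : ∀ n d (𝓕 : Family n) → d ! * shatteredCount 𝓕 d + badCount n d 𝓕 ≡ n ^ d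
  shattered+bad n d 𝓕 = begin
    d ! * shatteredCount 𝓕 d + badCount n d 𝓕
      ≡⟨ cong (_+ badCount n d 𝓕) (∑ᵛ-good n d 𝓕) ⟨
    ∑ᵛ n d (λ t → ⟦ good t ⟧) + ∑ᵛ n d (λ t → ⟦ not (good t) ⟧)
      ≡⟨ ∑ᵛ-distrib-+ d (λ t → ⟦ good t ⟧) (λ t → ⟦ not (good t) ⟧) ⟨
    ∑ᵛ n d (λ t → ⟦ good t ⟧ + ⟦ not (good t) ⟧)
      ≡⟨ ∑ᵛ-cong d (⟦⟧+⟦not⟧ ∘ good) ⟩
    ∑ᵛ n d (λ _ → 1)
      ≡⟨ ∑ᵛ-const d 1 ⟩
    n ^ d * 1
      ≡⟨ *-identityʳ (n ^ d) ⟩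
    n ^ d
      ∎
    where
    good : Vec (Fin n) d → Bool
    good t = does (good? 𝓕 t)

  -- The product family

  module _ {m n : ℕ} where

    π₁ : Fin (m * n) → Fin m
    π₁ = proj₁ ∘ remQuot {m} n

    π₂ : Fin (m * n) → Fin n
    π₂ = proj₂ ∘ remQuot {m} n

    π₁-zipWith-combine : ∀ {d} (s : Vec (Fin m) d) (t : Vec (Fin n) d) →
      Vec.map π₁ (zipWith combine s t) ≡ s
    π₁-zipWith-combine []      []      = refl
    π₁-zipWith-combine (i ∷ s) (j ∷ t) =
      cong₂ _∷_ (cong proj₁ (remQuot-combine i j)) (π₁-zipWith-combine s t)

    π₂-zipWith-combine : ∀ {d} (s : Vec (Fin m) d) (t : Vec (Fin n) d) →
      Vec.map π₂ (zipWith combine s t) ≡ t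
    π₂-zipWith-combine []      []      = refl
    π₂-zipWith-combine (i ∷ s) (j ∷ t) =
      cong₂ _∷_ (cong proj₂ (remQuot-combine i j)) (π₂-zipWith-combine s t)

    productFamily : Family m → Family n → Family (m * n)
    productFamily 𝓕₁ 𝓕₂ = map (preimage π₁) 𝓕₁ ++ map (preimage π₂) 𝓕₂

    length-productFamily : ∀ (𝓕₁ : Family m) 𝓕₂ →
      length (productFamily 𝓕₁ 𝓕₂) ≡ length 𝓕₁ + length 𝓕₂
    length-productFamily 𝓕₁ 𝓕₂ = trans
      (length-++ (map (preimage π₁) 𝓕₁))
      (cong₂ _+_ (length-map (preimage π₁) 𝓕₁) (length-map (preimage π₂) 𝓕₂))

    badCount-productFamily : ∀ d (𝓕₁ : Family m) 𝓕₂ →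
      badCount (m * n) d (productFamily 𝓕₁ 𝓕₂) ≤ badCount m d 𝓕₁ * badCount n d 𝓕₂
    badCount-productFamily d 𝓕₁ 𝓕₂ =
      ≤-trans (≤-reflexive (∑ᵛ-combine m n d (bad 𝓟)))
        (≤-trans (∑ᵛ-mono-≤ d (λ s → ∑ᵛ-mono-≤ d (bad-pair s)))
          (≤-reflexive (∑ᵛ-*-∑ᵛ m n d (bad 𝓕₁) (bad 𝓕₂))))
      where
      𝓟 = productFamily 𝓕₁ 𝓕₂
      bad : ∀ {k} → Family k → Vec (Fin k) d → ℕ
      bad 𝓕 t = ⟦ not (does (good? 𝓕 t)) ⟧
      bad-pair : ∀ s t → bad 𝓟 (zipWith combine s t) ≤ bad 𝓕₁ s * bad 𝓕₂ t
      bad-pair s t = ⟦not⟧-≤-* (good? 𝓕₁ s) (good? 𝓕₂ t) (good? 𝓟 u)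
        (good-preimage π₁ (∈-++⁺ˡ ∘ ∈-map⁺ (preimage π₁)) u ∘ subst (Good 𝓕₁) (sym (π₁-zipWith-combine s t)))
        (good-preimage π₂ (∈-++⁺ʳ _ ∘ ∈-map⁺ (preimage π₂)) u ∘ subst (Good 𝓕₂) (sym (π₂-zipWith-combine s t)))
        where u = zipWith combine s t

  ∈-allSubsets : ∀ {n} (A : Subset n) → A ∈ˡ allSubsets n
  ∈-allSubsets []                   = here refl
  ∈-allSubsets (outside ∷ A)        = ∈-++⁺ˡ (∈-map⁺ (outside ∷_) (∈-allSubsets A))
  ∈-allSubsets {suc n} (inside ∷ A) =
    ∈-++⁺ʳ (map (outside ∷_) (allSubsets n)) (∈-map⁺ (inside ∷_) (∈-allSubsets A))

  ∈-families⁺ : ∀ {n k} (𝓕 : Family n) → length 𝓕 ≤ k → 𝓕 ∈ˡ families n k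
  ∈-families⁺ {k = zero}  []      _ = here refl
  ∈-families⁺ {k = suc k} []      _ = here refl
  ∈-families⁺ {n} {suc k} (S ∷ 𝓕) (s≤s |𝓕|≤k) = there
    (∈-concatMap⁺ (λ S → map (S ∷_) (families n k))
      (lose (∈-allSubsets S) (∈-map⁺ (S ∷_) (∈-families⁺ 𝓕 |𝓕|≤k))))

  ∈-families⁻ : ∀ {n k} {𝓕 : Family n} → 𝓕 ∈ˡ families n k → length 𝓕 ≤ k
  ∈-families⁻ {k = zero}  (here refl) = z≤n
  ∈-families⁻ {k = suc k} (here refl) = z≤n
  ∈-families⁻ {n} {suc k} (there 𝓕∈)
    with _ , _ , 𝓕∈S∷ ← find (∈-concatMap⁻ (λ S → map (S ∷_) (families n k)) {xs = allSubsets n} 𝓕∈)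
    with _ , 𝓕′∈ , refl ← ∈-map⁻ _ 𝓕∈S∷
    = s≤s (∈-families⁻ 𝓕′∈)

  shatteredCount≤f : ∀ {n k} d (𝓕 : Family n) → length 𝓕 ≤ k → shatteredCount 𝓕 d ≤ f n k d
  shatteredCount≤f d 𝓕 |𝓕|≤k =
    foldr-preservesᵒ (λ x y → [ m≤n⇒m≤n⊔o y , m≤n⇒m≤o⊔n x ]) 0 _
      (inj₂ (Any.map ≤-reflexive (∈-map⁺ (λ 𝓕 → shatteredCount 𝓕 d) (∈-families⁺ 𝓕 |𝓕|≤k))))

  f-attained : ∀ n k d → ∃[ 𝓕 ] length 𝓕 ≤ k × f n k d ≡ shatteredCount 𝓕 d
  f-attained n k d with foldr-selective ⊔-sel 0 (map (λ 𝓕 → shatteredCount 𝓕 d) (families n k))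
  ... | inj₂ f∈ with 𝓕 , 𝓕∈ , f≡ ← ∈-map⁻ _ f∈ = 𝓕 , ∈-families⁻ 𝓕∈ , f≡
  ... | inj₁ f≡0 = [] , z≤n , trans f≡0 (sym (n≤0⇒n≡0 ∅≤0))
    where
    ∅≤0 : shatteredCount {n} [] d ≤ 0
    ∅≤0 = subst (shatteredCount {n} [] d ≤_) f≡0 (shatteredCount≤f {n} {k} d [] z≤n)

open import Defs
open import Data.Nat using (ℕ; _≤_; _^_; _!; _∸_) renaming (_*_ to _*ℕ_; _+_ to _+ℕ_)
open import Data.Nat.Properties using (m≤m+n; m+n∸m≡n; +-mono-≤)
open import Data.Integer using (+_; _-_; _*_; _⊖_; +≤+) renaming (_≤_ to _≤ℤ_)
open import Data.Integer.Properties
  using ([+m]-[+n]≡m⊖n; ⊖-≥; pos-*; +-monoʳ-≤; neg-mono-≤; *-monoˡ-≤-nonNeg; module ≤-Reasoning)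
open import Data.List using (length)
open import Data.Product using (_,_)
open import Relation.Binary.PropositionalEquality
  using (_≡_; sym; trans; cong; cong₂; subst; module ≡-Reasoning)
open Counting

[+a]-[+b]*[+c]≡+r : ∀ {a} b c {r} → b *ℕ c +ℕ r ≡ a → + a - + b * + c ≡ + r
[+a]-[+b]*[+c]≡+r {a} b c {r} bc+r≡a = begin
  + a - + b * + c           ≡⟨ cong (+ a -_) (pos-* b c) ⟨
  + a - + (b *ℕ c)          ≡⟨ [+m]-[+n]≡m⊖n a (b *ℕ c) ⟩
  a ⊖ b *ℕ c                ≡⟨ cong (_⊖ b *ℕ c) bc+r≡a ⟨
  b *ℕ c +ℕ r ⊖ b *ℕ c      ≡⟨ ⊖-≥ (m≤m+n (b *ℕ c) r) ⟩
  + (b *ℕ c +ℕ r ∸ b *ℕ c)  ≡⟨ cong +_ (m+n∸m≡n (b *ℕ c) r) ⟩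
  + r                       ∎
  where open ≡-Reasoning

n^d-d!*shatteredCount≡badCount : ∀ n d (𝓕 : Family n) →
  + (n ^ d) - + (d !) * + shatteredCount 𝓕 d ≡ + badCount n d 𝓕
n^d-d!*shatteredCount≡badCount n d 𝓕 =
  [+a]-[+b]*[+c]≡+r (d !) (shatteredCount 𝓕 d) (shattered+bad n d 𝓕)

lemma5p3 : (d k₁ k₂ n₁ n₂ : ℕ) → 1 ≤ d → 2 ^ d ≤ k₁ → 2 ^ d ≤ k₂ → d ≤ n₁ → d ≤ n₂ →
    (+ ((n₁ *ℕ n₂) ^ d)) - (+ (d !)) * (+ f (n₁ *ℕ n₂) (k₁ +ℕ k₂) d)
      ≤ℤ ((+ (n₁ ^ d)) - (+ (d !)) * (+ f n₁ k₁ d)) * ((+ (n₂ ^ d)) - (+ (d !)) * (+ f n₂ k₂ d))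
lemma5p3 d k₁ k₂ n₁ n₂ _ _ _ _ _
  with 𝓕₁ , |𝓕₁|≤k₁ , f₁≡ ← f-attained n₁ k₁ d
  with 𝓕₂ , |𝓕₂|≤k₂ , f₂≡ ← f-attained n₂ k₂ d = begin
  + ((n₁ *ℕ n₂) ^ d) - + (d !) * + f (n₁ *ℕ n₂) (k₁ +ℕ k₂) d
    ≤⟨ +-monoʳ-≤ (+ ((n₁ *ℕ n₂) ^ d)) (neg-mono-≤ (*-monoˡ-≤-nonNeg (+ (d !)) (+≤+ f≥))) ⟩
  + ((n₁ *ℕ n₂) ^ d) - + (d !) * + shatteredCount 𝓟 d
    ≡⟨ n^d-d!*shatteredCount≡badCount (n₁ *ℕ n₂) d 𝓟 ⟩
  + badCount (n₁ *ℕ n₂) d 𝓟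
    ≤⟨ +≤+ (badCount-productFamily d 𝓕₁ 𝓕₂) ⟩
  + (badCount n₁ d 𝓕₁ *ℕ badCount n₂ d 𝓕₂)
    ≡⟨ pos-* (badCount n₁ d 𝓕₁) (badCount n₂ d 𝓕₂) ⟩
  + badCount n₁ d 𝓕₁ * + badCount n₂ d 𝓕₂
    ≡⟨ cong₂ _*_ (n^d-d!*f≡badCount n₁ k₁ 𝓕₁ f₁≡) (n^d-d!*f≡badCount n₂ k₂ 𝓕₂ f₂≡) ⟨
  (+ (n₁ ^ d) - + (d !) * + f n₁ k₁ d) * (+ (n₂ ^ d) - + (d !) * + f n₂ k₂ d)
    ∎
  where
  open ≤-Reasoning
  𝓟 = productFamily 𝓕₁ 𝓕₂
  f≥ : shatteredCount 𝓟 d ≤ f (n₁ *ℕ n₂) (k₁ +ℕ k₂) d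
  f≥ = shatteredCount≤f d 𝓟
    (subst (_≤ k₁ +ℕ k₂) (sym (length-productFamily 𝓕₁ 𝓕₂)) (+-mono-≤ |𝓕₁|≤k₁ |𝓕₂|≤k₂))
  n^d-d!*f≡badCount : ∀ n k 𝓕 → f n k d ≡ shatteredCount 𝓕 d →
    + (n ^ d) - + (d !) * + f n k d ≡ + badCount n d 𝓕
  n^d-d!*f≡badCount n k 𝓕 f≡ =
    trans (cong (λ z → + (n ^ d) - + (d !) * + z) f≡) (n^d-d!*shatteredCount≡badCount n d 𝓕)
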